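{- Let $p$ be an odd prime and $a,b,c,d,e,k\in\mathbb{Z}$ with $d,e,k\ge1$ and $(b,p)=1$. Let $\zeta$ be a primitive $p^k$-th root of unity and define $g:\mathbb{Z}/p^k\mathbb{Z}\to\mathbb{Z}/p^k\mathbb{Z}$ by $g(t)=a+bt+cp\sum_{j=2}^{d}\binom{t}{j}p^{(j-2)e}$. Then $\sum_{t=0}^{p^k-1}\zeta^{g(t)}=0$. -}

module Defs where

open import Level using (_⊔_)
open import Algebra.Bundles using (CommutativeRing; Semiring)
import Algebra.Definitions.RawSemiring as RS
open import Data.Nat using (ℕ; zero; suc; _∸_; _<_; NonZero) renaming (_+_ to _+ℕ_; _*_ to _*ℕ_; _^_ to _^ℕ_)
open import Data.Nat.Combinatorics using (_C_)
open import Data.Integer using (ℤ; +_) renaming (_+_ to _+ℤ_; _*_ to _*ℤ_)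
open import Data.Integer.DivMod using (_%ℕ_)
open import Data.Fin using (Fin; toℕ)
open import Data.Sum using (_⊎_)
open import Relation.Nullary using (¬_)

pow : ∀ {c ℓ} (R : CommutativeRing c ℓ) → CommutativeRing.Carrier R → ℕ → CommutativeRing.Carrier R
pow R = RS._^_ (Semiring.rawSemiring (CommutativeRing.semiring R))

record IsIntegralDomain {c ℓ} (R : CommutativeRing c ℓ) : Set (c ⊔ ℓ) where
  open CommutativeRing R
  field
    1≉0 : ¬ (1# ≈ 0#)
    noZeroDivisors : ∀ x y → x * y ≈ 0# → (x ≈ 0#) ⊎ (y ≈ 0#)

record IsPrimitiveRoot {c ℓ} (R : CommutativeRing c ℓ) (n : ℕ) (ζ : CommutativeRing.Carrier R) : Set (c ⊔ ℓ) where
  open CommutativeRing R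
  field
    pow-n : pow R ζ n ≈ 1#
    pow-m : ∀ m → 0 < m → m < n → ¬ (pow R ζ m ≈ 1#)

sumFrom2 : (ℕ → ℤ) → ℕ → ℤ
sumFrom2 f zero = + 0
sumFrom2 f (suc zero) = + 0
sumFrom2 f (suc (suc d)) = sumFrom2 f (suc d) +ℤ f (suc (suc d))

gPoly : (p : ℕ) (a b c : ℤ) (d e : ℕ) → ℕ → ℤ
gPoly p a b c d e t =
  a +ℤ b *ℤ (+ t) +ℤ c *ℤ (+ p) *ℤ sumFrom2 (λ j → + ((t C j) *ℕ (p ^ℕ ((j ∸ 2) *ℕ e)))) d

-- Σ_{t=0}^{p^k-1} ζ^{g(t)}, where the exponent g(t) is taken as its residue mod p^k
-- (legitimate since ζ^{p^k} = 1).
gaussSum : ∀ {c ℓ} (R : CommutativeRing c ℓ) (ζ : CommutativeRing.Carrier R)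
           (p k : ℕ) .{{_ : NonZero (p ^ℕ k)}} (a b c : ℤ) (d e : ℕ) → CommutativeRing.Carrier R
gaussSum R ζ p k a b c d e = sum (λ (t : Fin (p ^ℕ k)) → ζ ^ (gPoly p a b c d e (toℕ t) %ℕ (p ^ℕ k)))
  where
  open CommutativeRing R
  open RS (Semiring.rawSemiring semiring) using (_^_; sum)

{-# OPTIONS --safe #-}
module Submission where

open import Defs

-- Put N = p^k and M = p^(k-1). For i ≥ 1 we have M ∣ i·C(M,i), and since i < p^(1 + (i ∸ 2)) the
-- p-part of i divides p^(i ∸ 2); hence N divides p^(1 + (i ∸ 2))·C(M,i). Pascal's rule turns this
-- into N ∣ p^(1 + (j ∸ 2))·(C(t+M, j) − C(t, j)) for all t and j, so g(t + M) ≡ g(t) + bM (mod N),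
-- and iterating p times gives g(t + N) ≡ g(t) (mod N). Reindexing the sum S by t ↦ t + M then gives
-- S = ζ^(bM) S, and ζ^(bM) ≠ 1 because p ∤ b; in an integral domain this forces S = 0.

module PrimePowerBinomials where

  open import Data.Nat
  open import Data.Nat.Properties
  open import Data.Nat.Divisibility
  open import Data.Nat.Combinatorics using (_C_; nCk+nC[k+1]≡[n+1]C[k+1]; nC1≡n)
  open import Data.Nat.Primality using (Prime; euclidsLemma; prime⇒nonZero)
  open import Data.Nat.Tactic.RingSolver using (solve-∀)
  open import Data.Sum using (inj₁; inj₂)
  open import Relation.Nullary.Negation using (contradiction)
  open import Relation.Binary.PropositionalEquality
  open ≡-Reasoning

  [k+1]*[n+1]C[k+1]≡[n+1]*nCk : ∀ n k → suc k * (suc n C suc k) ≡ suc n * (n C k)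
  [k+1]*[n+1]C[k+1]≡[n+1]*nCk zero    zero    = refl
  [k+1]*[n+1]C[k+1]≡[n+1]*nCk zero    (suc k) = *-zeroʳ (suc (suc k))
  [k+1]*[n+1]C[k+1]≡[n+1]*nCk (suc n) zero    = begin
    1 * (suc (suc n) C 1) ≡⟨ *-identityˡ _ ⟩
    suc (suc n) C 1       ≡⟨ nC1≡n (suc (suc n)) ⟩
    suc (suc n)           ≡⟨ *-identityʳ (suc (suc n)) ⟨
    suc (suc n) * 1       ∎
  [k+1]*[n+1]C[k+1]≡[n+1]*nCk (suc n) (suc k) = begin
    suc (suc k) * (suc (suc n) C suc (suc k))
      ≡⟨ cong (suc (suc k) *_) (nCk+nC[k+1]≡[n+1]C[k+1] (suc n) (suc k)) ⟨
    suc (suc k) * (X + Y)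
      ≡⟨ rearrange k X Y ⟩
    suc k * X + suc (suc k) * Y + X
      ≡⟨ cong₂ (λ u v → u + v + X) ([k+1]*[n+1]C[k+1]≡[n+1]*nCk n k)
                                   ([k+1]*[n+1]C[k+1]≡[n+1]*nCk n (suc k)) ⟩
    suc n * (n C k) + suc n * (n C suc k) + X
      ≡⟨ cong (_+ X) (*-distribˡ-+ (suc n) (n C k) (n C suc k)) ⟨
    suc n * (n C k + n C suc k) + X
      ≡⟨ cong (λ u → suc n * u + X) (nCk+nC[k+1]≡[n+1]C[k+1] n k) ⟩
    suc n * X + X
      ≡⟨ +-comm (suc n * X) X ⟩
    suc (suc n) * X ∎
    where
    X Y : ℕ
    X = suc n C suc k
    Y = suc n C suc (suc k)
    rearrange : ∀ k x y → suc (suc k) * (x + y) ≡ suc k * x + suc (suc k) * y + x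
    rearrange = solve-∀

  n∣k*nCk : ∀ n k → n ∣ k * (n C k)
  n∣k*nCk n       zero    = n ∣0
  n∣k*nCk zero    (suc k) = subst (0 ∣_) (sym (*-zeroʳ (suc k))) (0 ∣0)
  n∣k*nCk (suc n) (suc k) =
    divides (n C k) (trans ([k+1]*[n+1]C[k+1]≡[n+1]*nCk n k) (*-comm (suc n) (n C k)))

  p^[1+n∸2]∣p^[2+n∸2] : ∀ p n → p ^ suc (n ∸ 2) ∣ p ^ suc (suc n ∸ 2)
  p^[1+n∸2]∣p^[2+n∸2] p zero          = ∣-refl
  p^[1+n∸2]∣p^[2+n∸2] p (suc zero)    = ∣-refl
  p^[1+n∸2]∣p^[2+n∸2] p (suc (suc n)) = n∣m*n p

  module _ {p} (p-prime : Prime p) where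

    private instance
      p≢0 : NonZero p
      p≢0 = prime⇒nonZero p-prime

    -- Euclid's lemma peels one factor p at a time off either i or x.
    p^k∣i*x⇒p^k∣p^v*x : ∀ k v {i x} → 0 < i → i < p ^ suc v → p ^ k ∣ i * x → p ^ k ∣ p ^ v * x
    p^k∣i*x⇒p^k∣p^v*x zero    _ _ _ _ = 1∣ _
    p^k∣i*x⇒p^k∣p^v*x (suc k) v {i} {x} 0<i i<p^[1+v] p^[1+k]∣i*x
      with euclidsLemma i x p-prime (∣-trans (m∣m*n (p ^ k)) p^[1+k]∣i*x)
    ... | inj₂ (divides x′ refl) =
      subst (p ^ suc k ∣_) (swap p (p ^ v) x′)
        (*-monoʳ-∣ p (p^k∣i*x⇒p^k∣p^v*x k v 0<i i<p^[1+v]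
          (*-cancelˡ-∣ p (subst (p ^ suc k ∣_) (shuffle p i x′) p^[1+k]∣i*x))))
      where
      shuffle : ∀ p i x′ → i * (x′ * p) ≡ p * (i * x′)
      shuffle = solve-∀
      swap : ∀ p q x′ → p * (q * x′) ≡ q * (x′ * p)
      swap = solve-∀
    ... | inj₁ (divides zero refl) = contradiction 0<i (<-irrefl refl)
    ... | inj₁ (divides (suc i′) refl) with v
    ...   | zero   = contradiction i<p^[1+v]
                       (≤⇒≯ (subst (_≤ suc i′ * p) (sym (*-identityʳ p)) (m≤n*m p (suc i′))))
    ...   | suc v′ = subst (p ^ suc k ∣_) (sym (*-assoc p (p ^ v′) x))
        (*-monoʳ-∣ p (p^k∣i*x⇒p^k∣p^v*x k v′ z<s
          (*-cancelˡ-< p _ _ (subst (_< p * p ^ suc v′) (*-comm (suc i′) p) i<p^[1+v]))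
          (*-cancelˡ-∣ p (subst (p ^ suc k ∣_) (shuffle p (suc i′) x) p^[1+k]∣i*x))))
      where
      shuffle : ∀ p i x → i * p * x ≡ p * (i * x)
      shuffle = solve-∀

  -- The only place where p ≠ 2 is needed: for p = 2 the bound fails at n = 2.
  module _ {p} (3≤p : 3 ≤ p) where

    2+n<p^[1+n] : ∀ n → 2 + n < p ^ suc n
    2+n<p^[1+n] zero    = subst (2 <_) (sym (*-identityʳ p)) 3≤p
    2+n<p^[1+n] (suc n) = ≤-<-trans (2+n<p^[1+n] n) (^-monoʳ-< p (<-trans (s<s z<s) 3≤p) (n<1+n (suc n)))

    n<p^[1+n∸2] : ∀ n → n < p ^ suc (n ∸ 2)
    n<p^[1+n∸2] 0             = <-trans z<s (2+n<p^[1+n] 0)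
    n<p^[1+n∸2] 1             = <-trans (s<s z<s) (2+n<p^[1+n] 0)
    n<p^[1+n∸2] (suc (suc n)) = 2+n<p^[1+n] n

  p^[1+k]∣p^[1+i∸2]*p^kCi : ∀ {p} → Prime p → 3 ≤ p → ∀ k {i} → 0 < i →
                           p ^ suc k ∣ p ^ suc (i ∸ 2) * (p ^ k C i)
  p^[1+k]∣p^[1+i∸2]*p^kCi {p} p-prime 3≤p k {i} 0<i =
    subst (p ^ suc k ∣_) (sym (*-assoc p (p ^ (i ∸ 2)) (p ^ k C i)))
      (*-monoʳ-∣ p (p^k∣i*x⇒p^k∣p^v*x p-prime k (i ∸ 2) 0<i (n<p^[1+n∸2] 3≤p i) (n∣k*nCk (p ^ k) i)))

module IntegerCongruences where

  open import Data.Nat as ℕ using (ℕ; zero; suc; _∸_; _≤_; z<s; NonZero; nonTrivial⇒≢1)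
  import Data.Nat.Properties as ℕₚ
  import Data.Nat.Divisibility as ℕ
  open import Data.Nat.Combinatorics using (_C_; nCk+nC[k+1]≡[n+1]C[k+1])
  open import Data.Nat.Primality using (Prime; prime⇒nonTrivial)
  open import Data.Nat.Coprimality using (Coprime)
  open import Data.Integer using (ℤ; +_; -[1+_]; _+_; _-_; _*_; -_; ∣_∣)
  open import Data.Integer.Properties
    using (pos-+; pos-*; +-injective; neg-distribˡ-*; *-assoc; *-zeroʳ; +-identityʳ; *-distribˡ-+)
  open import Data.Integer.DivMod using (_%ℕ_; _/ℕ_; a≡a%ℕn+[a/ℕn]*n)
  open import Data.Integer.Divisibility.Signed
    using (_∣_; divides; ∣ᵤ⇒∣; ∣⇒∣ᵤ; ∣m∣n⇒∣m+n; ∣m⇒∣-m; ∣n⇒∣m*n; *-cancelʳ-∣)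
  open import Data.Integer.Tactic.RingSolver using (solve-∀)
  open import Data.Product using (∃-syntax; _,_)
  open import Data.Sum using (_⊎_; inj₁; inj₂)
  open import Relation.Binary.PropositionalEquality
  open ≡-Reasoning
  open PrimePowerBinomials

  ∣m*o⇒∣n*o : ∀ {d m n o} → m ∣ n → d ∣ m * o → d ∣ n * o
  ∣m*o⇒∣n*o {d} {m} {n} {o} (divides q refl) d∣m*o =
    subst (d ∣_) (sym (*-assoc q m o)) (∣n⇒∣m*n q d∣m*o)

  +r-+s≡+n*+N⇒r≡s+n*N : ∀ r s n N → + r - + s ≡ + n * + N → r ≡ s ℕ.+ n ℕ.* N
  +r-+s≡+n*+N⇒r≡s+n*N r s n N r-s≡n*N = +-injective (begin
    + r                ≡⟨ add-back (+ r) (+ s) ⟩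
    + s + (+ r - + s)  ≡⟨ cong (λ z → + s + z) (trans r-s≡n*N (sym (pos-* n N))) ⟩
    + s + + (n ℕ.* N)  ≡⟨ pos-+ s (n ℕ.* N) ⟨
    + (s ℕ.+ n ℕ.* N)  ∎)
    where
    add-back : ∀ r s → r ≡ s + (r - s)
    add-back = solve-∀

  ∣+r-+s⇒r≡s+n*N⊎s≡r+n*N : ∀ {N} r s → + N ∣ + r - + s →
                           (∃[ n ] r ≡ s ℕ.+ n ℕ.* N) ⊎ (∃[ n ] s ≡ r ℕ.+ n ℕ.* N)
  ∣+r-+s⇒r≡s+n*N⊎s≡r+n*N {N} r s (divides (+ n) r-s≡n*N) =
    inj₁ (n , +r-+s≡+n*+N⇒r≡s+n*N r s n N r-s≡n*N)
  ∣+r-+s⇒r≡s+n*N⊎s≡r+n*N {N} r s (divides -[1+ n ] r-s≡-[1+n]*N) =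
    inj₂ (suc n , +r-+s≡+n*+N⇒r≡s+n*N s r (suc n) N
      (trans (swap (+ r) (+ s)) (trans (cong -_ r-s≡-[1+n]*N) (neg-distribˡ-* -[1+ n ] (+ N)))))
    where
    swap : ∀ r s → s - r ≡ - (r - s)
    swap = solve-∀

  module _ (N : ℕ) .{{_ : NonZero N}} where

    ∣x-x%ℕN : ∀ x → + N ∣ x - + (x %ℕ N)
    ∣x-x%ℕN x = divides (x /ℕ N)
      (trans (cong (_- + (x %ℕ N)) (a≡a%ℕn+[a/ℕn]*n x N)) (cancel (+ (x %ℕ N)) (x /ℕ N * + N)))
      where
      cancel : ∀ r q → r + q - r ≡ q
      cancel = solve-∀

    ∣x-y⇒∣x%ℕN-y%ℕN : ∀ x y → + N ∣ x - y → + N ∣ + (x %ℕ N) - + (y %ℕ N)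
    ∣x-y⇒∣x%ℕN-y%ℕN x y N∣x-y =
      subst (+ N ∣_) (regroup x y (+ (x %ℕ N)) (+ (y %ℕ N)))
        (∣m∣n⇒∣m+n (∣m∣n⇒∣m+n N∣x-y (∣m⇒∣-m (∣x-x%ℕN x))) (∣x-x%ℕN y))
      where
      regroup : ∀ x y x′ y′ → (x - y) + - (x - x′) + (y - y′) ≡ x′ - y′
      regroup = solve-∀

    ∣[x+y]%ℕN-[x%ℕN+y%ℕN] : ∀ x y → + N ∣ + ((x + y) %ℕ N) - + (x %ℕ N ℕ.+ y %ℕ N)
    ∣[x+y]%ℕN-[x%ℕN+y%ℕN] x y =
      subst (+ N ∣_)
        (trans (regroup x y (+ ((x + y) %ℕ N)) (+ (x %ℕ N)) (+ (y %ℕ N)))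
               (cong (λ z → + ((x + y) %ℕ N) - z) (sym (pos-+ (x %ℕ N) (y %ℕ N)))))
        (∣m∣n⇒∣m+n (∣m∣n⇒∣m+n (∣m⇒∣-m (∣x-x%ℕN (x + y))) (∣x-x%ℕN x)) (∣x-x%ℕN y))
      where
      regroup : ∀ x y s′ x′ y′ → - ((x + y) - s′) + (x - x′) + (y - y′) ≡ s′ - (x′ + y′)
      regroup = solve-∀

  [b*m]%ℕ[p*m]≢0 : ∀ {p} → Prime p → ∀ b m .{{_ : NonZero (p ℕ.* m)}} → Coprime ∣ b ∣ p →
                   (b * + m) %ℕ (p ℕ.* m) ≢ 0
  [b*m]%ℕ[p*m]≢0 {p} p-prime b m b⊥p r≡0 =
    nonTrivial⇒≢1 {{prime⇒nonTrivial p-prime}} (b⊥p (∣⇒∣ᵤ p∣b , ℕ.∣-refl))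
    where
    instance
      m≢0 : NonZero m
      m≢0 = ℕₚ.m*n≢0⇒n≢0 p
    p*m∣b*m : + p * + m ∣ b * + m
    p*m∣b*m = subst₂ _∣_ (pos-* p m) (trans (cong (λ r → b * + m - + r) r≡0) (+-identityʳ (b * + m)))
                (∣x-x%ℕN (p ℕ.* m) (b * + m))
    p∣b : + p ∣ b
    p∣b = *-cancelʳ-∣ (+ m) p*m∣b*m

  ∣-sumFrom2-difference : ∀ {n} m (f g : ℕ → ℤ) → (∀ j → n ∣ m * (f j - g j)) →
                          ∀ d → n ∣ m * (sumFrom2 f d - sumFrom2 g d)
  ∣-sumFrom2-difference m f g _ zero       = ∣n⇒∣m*n m (divides (+ 0) refl)
  ∣-sumFrom2-difference m f g _ (suc zero) = ∣n⇒∣m*n m (divides (+ 0) refl)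
  ∣-sumFrom2-difference {n} m f g n∣m*[f-g] (suc (suc d)) =
    subst (n ∣_) (sym (distrib m (sumFrom2 f (suc d)) (f (suc (suc d))) (sumFrom2 g (suc d)) (g (suc (suc d)))))
      (∣m∣n⇒∣m+n (∣-sumFrom2-difference m f g n∣m*[f-g] (suc d)) (n∣m*[f-g] (suc (suc d))))
    where
    distrib : ∀ m x y x′ y′ → m * ((x + y) - (x′ + y′)) ≡ m * (x - x′) + m * (y - y′)
    distrib = solve-∀

  module _ {n B : ℤ} {m : ℕ} (G : ℕ → ℤ) (shift : ∀ t → n ∣ G (t ℕ.+ m) - (G t + B)) where

    shift-iterate : ∀ q t → n ∣ G (t ℕ.+ q ℕ.* m) - (G t + + q * B)
    shift-iterate zero t = subst (n ∣_) (sym G[t+0]-G[t]≡0) (divides (+ 0) refl)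
      where
      cancel : ∀ x → x - (x + + 0) ≡ + 0
      cancel = solve-∀
      G[t+0]-G[t]≡0 : G (t ℕ.+ 0) - (G t + + 0) ≡ + 0
      G[t+0]-G[t]≡0 = trans (cong (λ s → G s - (G t + + 0)) (ℕₚ.+-identityʳ t)) (cancel (G t))
    shift-iterate (suc q) t =
      subst (n ∣_) (sym split) (∣m∣n⇒∣m+n (shift (t ℕ.+ q ℕ.* m)) (shift-iterate q t))
      where
      t′ : ℕ
      t′ = t ℕ.+ q ℕ.* m
      t+[1+q]*m≡t′+m : t ℕ.+ suc q ℕ.* m ≡ t′ ℕ.+ m
      t+[1+q]*m≡t′+m = trans (cong (t ℕ.+_) (ℕₚ.+-comm m (q ℕ.* m))) (sym (ℕₚ.+-assoc t (q ℕ.* m) m))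
      regroup : ∀ x y z q B → x - (z + (+ 1 + q) * B) ≡ (x - (y + B)) + (y - (z + q * B))
      regroup = solve-∀
      split : G (t ℕ.+ suc q ℕ.* m) - (G t + + suc q * B)
              ≡ (G (t′ ℕ.+ m) - (G t′ + B)) + (G t′ - (G t + + q * B))
      split = trans (cong₂ (λ s r → G s - (G t + r * B)) t+[1+q]*m≡t′+m (pos-+ 1 q))
                    (regroup (G (t′ ℕ.+ m)) (G t′) (G t) (+ q) B)

  module _ {p} (p-prime : Prime p) (3≤p : 3 ≤ p) (k : ℕ) where

    private
      M N : ℕ
      M = p ℕ.^ k
      N = p ℕ.^ suc k

    p^[1+k]∣p^[1+j∸2]*[[t+p^k]Cj-tCj] : ∀ t j →
      + N ∣ + (p ℕ.^ suc (j ∸ 2)) * (+ ((t ℕ.+ M) C j) - + (t C j))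
    p^[1+k]∣p^[1+j∸2]*[[t+p^k]Cj-tCj] t zero =
      subst (+ N ∣_) (sym (*-zeroʳ (+ (p ℕ.^ 1)))) (divides (+ 0) refl)
    p^[1+k]∣p^[1+j∸2]*[[t+p^k]Cj-tCj] zero (suc j) =
      subst (+ N ∣_) (trans (pos-* a x) (cong (+ a *_) (sym (+-identityʳ (+ x)))))
        (∣ᵤ⇒∣ {+ _} {+ _} (p^[1+k]∣p^[1+i∸2]*p^kCi p-prime 3≤p k {suc j} z<s))
      where
      a x : ℕ
      a = p ℕ.^ suc (suc j ∸ 2)
      x = M C suc j
    p^[1+k]∣p^[1+j∸2]*[[t+p^k]Cj-tCj] (suc t) (suc j) =
      subst (+ N ∣_) (sym (trans (cong (+ a *_) pascal) (*-distribˡ-+ (+ a) (Δ j) (Δ (suc j)))))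
        (∣m∣n⇒∣m+n (∣m*o⇒∣n*o (∣ᵤ⇒∣ {+ _} {+ _} (p^[1+n∸2]∣p^[2+n∸2] p j))
                              (p^[1+k]∣p^[1+j∸2]*[[t+p^k]Cj-tCj] t j))
                   (p^[1+k]∣p^[1+j∸2]*[[t+p^k]Cj-tCj] t (suc j)))
      where
      a : ℕ
      a = p ℕ.^ suc (suc j ∸ 2)
      Δ : ℕ → ℤ
      Δ i = + ((t ℕ.+ M) C i) - + (t C i)
      x₀ x₁ y₀ y₁ : ℕ
      x₀ = (t ℕ.+ M) C j
      x₁ = (t ℕ.+ M) C suc j
      y₀ = t C j
      y₁ = t C suc j
      regroup : ∀ x x′ y y′ → (x + x′) - (y + y′) ≡ (x - y) + (x′ - y′)
      regroup = solve-∀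
      pascal : + ((suc t ℕ.+ M) C suc j) - + (suc t C suc j) ≡ Δ j + Δ (suc j)
      pascal = begin
        + ((suc t ℕ.+ M) C suc j) - + (suc t C suc j)
          ≡⟨ cong₂ (λ u v → + u - + v) (nCk+nC[k+1]≡[n+1]C[k+1] (t ℕ.+ M) j)
                                       (nCk+nC[k+1]≡[n+1]C[k+1] t j) ⟨
        + (x₀ ℕ.+ x₁) - + (y₀ ℕ.+ y₁)
          ≡⟨ cong₂ _-_ (pos-+ x₀ x₁) (pos-+ y₀ y₁) ⟩
        (+ x₀ + + x₁) - (+ y₀ + + y₁)
          ≡⟨ regroup (+ x₀) (+ x₁) (+ y₀) (+ y₁) ⟩
        Δ j + Δ (suc j) ∎

    module _ (a b c : ℤ) (d e : ℕ) where

      private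
        G : ℕ → ℤ
        G = gPoly p a b c d (suc e)

        term : ℕ → ℕ → ℤ
        term t j = + ((t C j) ℕ.* p ℕ.^ ((j ∸ 2) ℕ.* suc e))

      -- p·p^((j ∸ 2)(1+e)) is a multiple of p^(1 + (j ∸ 2)); this is where e ≥ 1 enters.
      p^[1+k]∣p*[term[t+p^k]-term[t]] : ∀ t j → + N ∣ + p * (term (t ℕ.+ M) j - term t j)
      p^[1+k]∣p*[term[t+p^k]-term[t]] t j =
        subst (+ N ∣_) rearranged (∣n⇒∣m*n (+ w) (p^[1+k]∣p^[1+j∸2]*[[t+p^k]Cj-tCj] t j))
        where
        x′ x v w : ℕ
        x′ = (t ℕ.+ M) C j
        x  = t C j
        v  = p ℕ.^ (j ∸ 2)
        w  = p ℕ.^ ((j ∸ 2) ℕ.* e)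
        pos-term : ∀ y → + (y ℕ.* p ℕ.^ ((j ∸ 2) ℕ.* suc e)) ≡ + y * (+ v * + w)
        pos-term y = begin
          + (y ℕ.* p ℕ.^ ((j ∸ 2) ℕ.* suc e))
            ≡⟨ cong (λ z → + (y ℕ.* p ℕ.^ z)) (ℕₚ.*-suc (j ∸ 2) e) ⟩
          + (y ℕ.* p ℕ.^ ((j ∸ 2) ℕ.+ (j ∸ 2) ℕ.* e))
            ≡⟨ cong (λ z → + (y ℕ.* z)) (ℕₚ.^-distribˡ-+-* p (j ∸ 2) _) ⟩
          + (y ℕ.* (v ℕ.* w))
            ≡⟨ trans (pos-* y (v ℕ.* w)) (cong (+ y *_) (pos-* v w)) ⟩
          + y * (+ v * + w) ∎
        shuffle : ∀ p v w x′ x → w * ((p * v) * (x′ - x)) ≡ p * (x′ * (v * w) - x * (v * w))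
        shuffle = solve-∀
        rearranged : + w * (+ (p ℕ.^ suc (j ∸ 2)) * (+ x′ - + x)) ≡ + p * (term (t ℕ.+ M) j - term t j)
        rearranged = begin
          + w * (+ (p ℕ.* v) * (+ x′ - + x))
            ≡⟨ cong (λ z → + w * (z * (+ x′ - + x))) (pos-* p v) ⟩
          + w * ((+ p * + v) * (+ x′ - + x))
            ≡⟨ shuffle (+ p) (+ v) (+ w) (+ x′) (+ x) ⟩
          + p * (+ x′ * (+ v * + w) - + x * (+ v * + w))
            ≡⟨ cong₂ (λ y z → + p * (y - z)) (pos-term x′) (pos-term x) ⟨
          + p * (term (t ℕ.+ M) j - term t j) ∎

      gPoly-shift : ∀ t → + N ∣ G (t ℕ.+ M) - (G t + b * + M)
      gPoly-shift t =
        subst (+ N ∣_) (sym regroup)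
          (∣n⇒∣m*n c (∣-sumFrom2-difference (+ p) (term (t ℕ.+ M)) (term t)
                                             (p^[1+k]∣p*[term[t+p^k]-term[t]] t) d))
        where
        S′ S : ℤ
        S′ = sumFrom2 (term (t ℕ.+ M)) d
        S  = sumFrom2 (term t) d
        cancel : ∀ a b t M c p S′ S →
                 (a + b * (t + M) + c * p * S′) - ((a + b * t + c * p * S) + b * M) ≡ c * (p * (S′ - S))
        cancel = solve-∀
        regroup : G (t ℕ.+ M) - (G t + b * + M) ≡ c * (+ p * (S′ - S))
        regroup = trans (cong (λ z → a + b * z + c * + p * S′ - (G t + b * + M)) (pos-+ t M))
                        (cancel a b (+ t) (+ M) c (+ p) S′ S)

      gPoly-periodic : ∀ t → + N ∣ G (t ℕ.+ N) - G t
      gPoly-periodic t =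
        subst (+ N ∣_) (cancel (G (t ℕ.+ N)) (G t) (+ p * (b * + M)))
          (∣m∣n⇒∣m+n (shift-iterate G gPoly-shift p t) N∣p*b*M)
        where
        cancel : ∀ x y z → x - (y + z) + z ≡ x - y
        cancel = solve-∀
        swap : ∀ x y z → x * (y * z) ≡ y * (x * z)
        swap = solve-∀
        N∣p*b*M : + N ∣ + p * (b * + M)
        N∣p*b*M = divides b (trans (swap (+ p) b (+ M)) (cong (b *_) (sym (pos-* p M))))

module RootOfUnitySums where

  open import Algebra.Bundles using (CommutativeMonoid; Semiring; CommutativeRing)
  open import Data.Nat as ℕ using (ℕ; zero; suc; NonZero)
  import Data.Nat.Properties as ℕₚ
  open import Data.Fin using (toℕ; inject₁; fromℕ)
  open import Data.Fin.Properties using (toℕ-inject₁; toℕ-fromℕ)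
  open import Data.Integer as ℤ using (ℤ; +_)
  open import Data.Integer.DivMod using (_%ℕ_)
  open import Data.Integer.Divisibility.Signed using (_∣_)
  open import Data.Product using (_,_)
  open import Data.Sum using (inj₁; inj₂)
  open import Function using (_∘_)
  open import Relation.Nullary using (¬_; contradiction)
  open import Relation.Binary.PropositionalEquality as ≡ using (_≡_)
  open IntegerCongruences

  module _ {c ℓ} (M : CommutativeMonoid c ℓ) where
    open CommutativeMonoid M renaming (_∙_ to _+_)
    open import Algebra.Properties.CommutativeMonoid.Sum M using (sum-syntax; sum-init-last; sum-cong-≗)
    open import Relation.Binary.Reasoning.Setoid setoid

    sum-rotate : ∀ n (f : ℕ → Carrier) → f n ≈ f 0 →
                 ∑[ i < n ] f (suc (toℕ i)) ≈ ∑[ i < n ] f (toℕ i)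
    sum-rotate zero    f _     = refl
    sum-rotate (suc n) f fn≈f0 = begin
      ∑[ i < suc n ] f (suc (toℕ i))
        ≈⟨ sum-init-last (λ i → f (suc (toℕ i))) ⟩
      ∑[ i < n ] f (suc (toℕ (inject₁ i))) + f (suc (toℕ (fromℕ n)))
        ≡⟨ ≡.cong₂ _+_ (sum-cong-≗ {n} (≡.cong (f ∘ suc) ∘ toℕ-inject₁))
                       (≡.cong (f ∘ suc) (toℕ-fromℕ n)) ⟩
      ∑[ i < n ] f (suc (toℕ i)) + f (suc n)
        ≈⟨ ∙-congˡ fn≈f0 ⟩
      ∑[ i < n ] f (suc (toℕ i)) + f 0
        ≈⟨ comm _ _ ⟩
      ∑[ i < suc n ] f (toℕ i) ∎

    sum-periodic-shift : ∀ {n} (f : ℕ → Carrier) → (∀ t → f (t ℕ.+ n) ≈ f t) →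
                         ∀ m → ∑[ i < n ] f (m ℕ.+ toℕ i) ≈ ∑[ i < n ] f (toℕ i)
    sum-periodic-shift     f _        zero    = refl
    sum-periodic-shift {n} f periodic (suc m) =
      trans (sum-periodic-shift (f ∘ suc) (periodic ∘ suc) m) (sum-rotate n f (periodic 0))

  module _ {c ℓ} (S : Semiring c ℓ) {ζ : Semiring.Carrier S} {N : ℕ} .{{_ : NonZero N}} where
    open Semiring S
    open import Algebra.Properties.Semiring.Exp S using (_^_; ^-homo-*; ^-congʳ)

    module _ (ζ^N≈1 : ζ ^ N ≈ 1#) where

      ζ^[n*N]≈1 : ∀ n → ζ ^ (n ℕ.* N) ≈ 1#
      ζ^[n*N]≈1 zero    = refl
      ζ^[n*N]≈1 (suc n) =
        trans (^-homo-* ζ N (n ℕ.* N)) (trans (*-cong ζ^N≈1 (ζ^[n*N]≈1 n)) (*-identityˡ 1#))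

      ζ^[r+n*N]≈ζ^r : ∀ r n → ζ ^ (r ℕ.+ n ℕ.* N) ≈ ζ ^ r
      ζ^[r+n*N]≈ζ^r r n =
        trans (^-homo-* ζ r (n ℕ.* N)) (trans (*-congˡ (ζ^[n*N]≈1 n)) (*-identityʳ (ζ ^ r)))

      ∣r-s⇒ζ^r≈ζ^s : ∀ r s → + N ∣ + r ℤ.- + s → ζ ^ r ≈ ζ ^ s
      ∣r-s⇒ζ^r≈ζ^s r s N∣r-s with ∣+r-+s⇒r≡s+n*N⊎s≡r+n*N r s N∣r-s
      ... | inj₁ (n , r≡s+n*N) = trans (^-congʳ ζ r≡s+n*N) (ζ^[r+n*N]≈ζ^r s n)
      ... | inj₂ (n , s≡r+n*N) = sym (trans (^-congʳ ζ s≡r+n*N) (ζ^[r+n*N]≈ζ^r r n))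

      ∣x-y⇒ζ^[x%ℕN]≈ζ^[y%ℕN] : ∀ x y → + N ∣ x ℤ.- y → ζ ^ (x %ℕ N) ≈ ζ ^ (y %ℕ N)
      ∣x-y⇒ζ^[x%ℕN]≈ζ^[y%ℕN] x y N∣x-y =
        ∣r-s⇒ζ^r≈ζ^s (x %ℕ N) (y %ℕ N) (∣x-y⇒∣x%ℕN-y%ℕN N x y N∣x-y)

      ζ^[[x+y]%ℕN]≈ζ^[x%ℕN]*ζ^[y%ℕN] : ∀ x y →
                                          ζ ^ ((x ℤ.+ y) %ℕ N) ≈ ζ ^ (x %ℕ N) * ζ ^ (y %ℕ N)
      ζ^[[x+y]%ℕN]≈ζ^[x%ℕN]*ζ^[y%ℕN] x y =
        trans (∣r-s⇒ζ^r≈ζ^s ((x ℤ.+ y) %ℕ N) (x %ℕ N ℕ.+ y %ℕ N) (∣[x+y]%ℕN-[x%ℕN+y%ℕN] N x y))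
              (^-homo-* ζ (x %ℕ N) (y %ℕ N))

  module _ {c ℓ} (R : CommutativeRing c ℓ) where
    open CommutativeRing R
    open import Algebra.Properties.Ring ring using ([y-z]x≈yx-zx; x≈y⇒x∙y⁻¹≈ε; x∙y⁻¹≈ε⇒x≈y)
    open import Algebra.Properties.Semiring.Exp semiring using (_^_)
    open import Algebra.Properties.Semiring.Sum semiring using (sum-syntax; sum-cong-≋; *-distribˡ-sum)
    open import Relation.Binary.Reasoning.Setoid setoid

    x≈y*x⇒x≈0 : IsIntegralDomain R → ∀ {x y} → ¬ y ≈ 1# → x ≈ y * x → x ≈ 0#
    x≈y*x⇒x≈0 domain {x} {y} y≉1 x≈y*x with IsIntegralDomain.noZeroDivisors domain (1# - y) x [1-y]*x≈0
      where
      [1-y]*x≈0 : (1# - y) * x ≈ 0#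
      [1-y]*x≈0 = begin
        (1# - y) * x    ≈⟨ [y-z]x≈yx-zx x 1# y ⟩
        1# * x - y * x  ≈⟨ +-congʳ (*-identityˡ x) ⟩
        x - y * x       ≈⟨ x≈y⇒x∙y⁻¹≈ε x≈y*x ⟩
        0#              ∎
    ... | inj₁ 1-y≈0 = contradiction (sym (x∙y⁻¹≈ε⇒x≈y 1# y 1-y≈0)) y≉1
    ... | inj₂ x≈0   = x≈0

    module _ {ζ : Carrier} {N : ℕ} .{{_ : NonZero N}} (ζ^N≈1 : ζ ^ N ≈ 1#)
             (G : ℕ → ℤ) {m : ℕ} {B : ℤ}
             (G-periodic : ∀ t → + N ∣ G (t ℕ.+ N) ℤ.- G t)
             (G-shift : ∀ t → + N ∣ G (t ℕ.+ m) ℤ.- (G t ℤ.+ B)) where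

      private
        F : ℕ → Carrier
        F t = ζ ^ (G t %ℕ N)

        F-periodic : ∀ t → F (t ℕ.+ N) ≈ F t
        F-periodic t = ∣x-y⇒ζ^[x%ℕN]≈ζ^[y%ℕN] semiring ζ^N≈1 (G (t ℕ.+ N)) (G t) (G-periodic t)

        F-shift : ∀ t → F (m ℕ.+ t) ≈ ζ ^ (B %ℕ N) * F t
        F-shift t = begin
          F (m ℕ.+ t)
            ≡⟨ ≡.cong F (ℕₚ.+-comm m t) ⟩
          F (t ℕ.+ m)
            ≈⟨ ∣x-y⇒ζ^[x%ℕN]≈ζ^[y%ℕN] semiring ζ^N≈1 (G (t ℕ.+ m)) (G t ℤ.+ B) (G-shift t) ⟩
          ζ ^ ((G t ℤ.+ B) %ℕ N)
            ≈⟨ ζ^[[x+y]%ℕN]≈ζ^[x%ℕN]*ζ^[y%ℕN] semiring ζ^N≈1 (G t) B ⟩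
          F t * ζ ^ (B %ℕ N)
            ≈⟨ *-comm (F t) (ζ ^ (B %ℕ N)) ⟩
          ζ ^ (B %ℕ N) * F t ∎

      ∑ζ^G≈ζ^B*∑ζ^G : ∑[ t < N ] F (toℕ t) ≈ ζ ^ (B %ℕ N) * ∑[ t < N ] F (toℕ t)
      ∑ζ^G≈ζ^B*∑ζ^G = begin
        ∑[ t < N ] F (toℕ t)                   ≈⟨ sum-periodic-shift +-commutativeMonoid F F-periodic m ⟨
        ∑[ t < N ] F (m ℕ.+ toℕ t)             ≈⟨ sum-cong-≋ {N} (F-shift ∘ toℕ) ⟩
        ∑[ t < N ] (ζ ^ (B %ℕ N) * F (toℕ t))  ≈⟨ *-distribˡ-sum {N} (ζ ^ (B %ℕ N)) (F ∘ toℕ) ⟨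
        ζ ^ (B %ℕ N) * ∑[ t < N ] F (toℕ t)    ∎

open import Algebra.Bundles using (CommutativeRing)
open import Data.Nat using (ℕ; suc; _≤_; _^_; NonZero; nonTrivial⇒n>1)
open import Data.Nat.Properties using (≤∧≢⇒<; n≢0⇒n>0)
open import Data.Nat.Primality using (Prime; prime⇒nonTrivial)
open import Data.Nat.Coprimality using (Coprime)
open import Data.Integer using (ℤ; ∣_∣; +_; _*_)
open import Data.Integer.DivMod using (_%ℕ_; n%ℕd<d)
open import Function using (_∘_)
open import Relation.Binary.PropositionalEquality using (_≢_; sym)
open import Relation.Nullary using (¬_)
open IntegerCongruences
open RootOfUnitySums

corollary5p8 : ∀ {c ℓ} (R : CommutativeRing c ℓ) → IsIntegralDomain R →
               (p : ℕ) → Prime p → p ≢ 2 →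
               (a b c' : ℤ) (d e k : ℕ) → 1 ≤ d → 1 ≤ e → 1 ≤ k →
               Coprime ∣ b ∣ p →
               (ζ : CommutativeRing.Carrier R) → IsPrimitiveRoot R (p ^ k) ζ →
               .{{_ : NonZero (p ^ k)}} →
               CommutativeRing._≈_ R (gaussSum R ζ p k a b c' d e) (CommutativeRing.0# R)
corollary5p8 R domain p p-prime p≢2 a b c d (suc e) (suc k) _ _ _ b⊥p ζ ζ-primitive =
  x≈y*x⇒x≈0 R domain ζ^r≉1
    (∑ζ^G≈ζ^B*∑ζ^G R pow-n (gPoly p a b c d (suc e))
      (gPoly-periodic p-prime 3≤p k a b c d e) (gPoly-shift p-prime 3≤p k a b c d e))
  where
  open IsPrimitiveRoot ζ-primitive
  open CommutativeRing R using (_≈_; 1#)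
  3≤p : 3 ≤ p
  3≤p = ≤∧≢⇒< (nonTrivial⇒n>1 p {{prime⇒nonTrivial p-prime}}) (p≢2 ∘ sym)
  r : ℕ
  r = (b * + (p ^ k)) %ℕ p ^ suc k
  ζ^r≉1 : ¬ pow R ζ r ≈ 1#
  ζ^r≉1 = pow-m r (n≢0⇒n>0 ([b*m]%ℕ[p*m]≢0 p-prime b (p ^ k) b⊥p)) (n%ℕd<d (b * + (p ^ k)) (p ^ suc k))
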